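{- Let $k\ge 3$. For $1\le n\le k-1$, $W^{(k)}_n=W^{(k)}_{n-1}W^{(k)}_{n-2}\cdots W^{(k)}_{0}\, n$, i.e. the concatenation of $W^{(k)}_{n-1},W^{(k)}_{n-2},\dots,W^{(k)}_0$ in this order, followed by the letter $n$.
   Context: The alphabet is $\mathbb{N}=\{0,1,2,\dots\}$. For an integer $k\ge 3$, $\varphi_k$ is the morphism of $\mathbb{N}^*$ defined on letters, for $i\ge 0$ and $0\le j\le k-1$, by $\varphi_k(ki+j)=(ki)(ki+j+1)$ (two letters) if $0\le j\le k-2$, and $\varphi_k(ki+k-1)=(ki+k)$ (one letter). For $n\ge 0$, $W^{(k)}_n=\varphi_k^n(0)$. -}

module Defs where

open import Data.Nat using (ℕ; zero; suc; _+_; _*_; _∸_; NonZero)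
open import Data.Nat.DivMod using (_/_; _%_)
open import Data.List using (List; []; _∷_; _++_; concatMap)
open import Relation.Nullary using (yes; no)
open import Data.Nat using (_≟_)

Word : Set
Word = List ℕ

φ-letter : (k : ℕ) → .{{_ : NonZero k}} → ℕ → Word
φ-letter k a with a % k ≟ k ∸ 1
... | yes _ = (k * (a / k) + k) ∷ []
... | no  _ = (k * (a / k)) ∷ (k * (a / k) + (a % k) + 1) ∷ []

φ : (k : ℕ) → .{{_ : NonZero k}} → Word → Word
φ k w = concatMap (φ-letter k) w

φ^ : (k : ℕ) → .{{_ : NonZero k}} → ℕ → Word → Word
φ^ k zero    w = w
φ^ k (suc n) w = φ k (φ^ k n w)

W : (k : ℕ) → .{{_ : NonZero k}} → ℕ → Word
W k n = φ^ k n (0 ∷ [])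

Wdesc : (k : ℕ) → .{{_ : NonZero k}} → ℕ → Word
Wdesc k zero    = []
Wdesc k (suc m) = W k m ++ Wdesc k m

-- Each letter m < k - 1 is mapped by φ_k to 0 (m+1).  Applying φ_k to
-- W_{n-1} ⋯ W_0 n therefore gives φ_k(W_{n-1} ⋯ W_0) 0 (n+1), and since
-- φ_k(W_i) = W_{i+1} and W_0 = 0, the prefix φ_k(W_{n-1} ⋯ W_0) 0 is W_n ⋯ W_0.
module Submission where

open import Data.Nat using (ℕ; zero; suc; _≤_; _<_; _∸_; _≟_; NonZero; _+_; _*_; _%_; _/_)
open import Data.Nat.Properties using (*-zeroʳ; <⇒≢; ≤-trans; m∸n≤m; n≤1+n; +-comm)
open import Data.Nat.DivMod using (m<n⇒m%n≡m; m<n⇒m/n≡0)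
open import Data.List using ([]; _∷_; _++_)
open import Data.List.Properties using (++-assoc; ++-identityʳ; concatMap-++)
open import Relation.Nullary using (yes; no; contradiction; ¬_)
open import Relation.Binary.PropositionalEquality
  using (_≡_; refl; sym; trans; cong; cong₂; module ≡-Reasoning)
open import Defs

φ-++ : (k : ℕ) → .{{_ : NonZero k}} → (u v : Word) → φ k (u ++ v) ≡ φ k u ++ φ k v
φ-++ k = concatMap-++ (φ-letter k)

φ-[_] : (k : ℕ) → .{{_ : NonZero k}} → (a : ℕ) → φ k (a ∷ []) ≡ φ-letter k a
φ-[_] k a = ++-identityʳ (φ-letter k a)

φ-letter-%≢ : (k : ℕ) → .{{_ : NonZero k}} → (a : ℕ) → ¬ (a % k ≡ k ∸ 1) →
              φ-letter k a ≡ k * (a / k) ∷ k * (a / k) + a % k + 1 ∷ []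
φ-letter-%≢ k a a%k≢k∸1 with a % k ≟ k ∸ 1
... | yes a%k≡k∸1 = contradiction a%k≡k∸1 a%k≢k∸1
... | no _        = refl

φ-letter-<∸1 : (k : ℕ) → .{{_ : NonZero k}} → (m : ℕ) → m < k ∸ 1 →
               φ-letter k m ≡ 0 ∷ suc m ∷ []
φ-letter-<∸1 k m m<k∸1 = begin
  φ-letter k m
    ≡⟨ φ-letter-%≢ k m m%k≢k∸1 ⟩
  k * (m / k) ∷ k * (m / k) + m % k + 1 ∷ []
    ≡⟨ cong₂ (λ q r → k * q ∷ k * q + r + 1 ∷ []) m/k≡0 m%k≡m ⟩
  k * 0 ∷ k * 0 + m + 1 ∷ []
    ≡⟨ cong (λ z → z ∷ z + m + 1 ∷ []) (*-zeroʳ k) ⟩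
  0 ∷ m + 1 ∷ []
    ≡⟨ cong (λ x → 0 ∷ x ∷ []) (+-comm m 1) ⟩
  0 ∷ suc m ∷ []
    ∎
  where
  open ≡-Reasoning
  m<k : m < k
  m<k = ≤-trans m<k∸1 (m∸n≤m k 1)
  m%k≡m : m % k ≡ m
  m%k≡m = m<n⇒m%n≡m m<k
  m/k≡0 : m / k ≡ 0
  m/k≡0 = m<n⇒m/n≡0 m<k
  m%k≢k∸1 : ¬ (m % k ≡ k ∸ 1)
  m%k≢k∸1 m%k≡k∸1 = <⇒≢ m<k∸1 (trans (sym m%k≡m) m%k≡k∸1)

φ-Wdesc : (k : ℕ) → .{{_ : NonZero k}} → (n : ℕ) →
          φ k (Wdesc k n) ++ 0 ∷ [] ≡ Wdesc k (suc n)
φ-Wdesc k zero    = refl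
φ-Wdesc k (suc n) = begin
  φ k (W k n ++ Wdesc k n) ++ 0 ∷ []         ≡⟨ cong (_++ 0 ∷ []) (φ-++ k (W k n) (Wdesc k n)) ⟩
  (W k (suc n) ++ φ k (Wdesc k n)) ++ 0 ∷ [] ≡⟨ ++-assoc (W k (suc n)) (φ k (Wdesc k n)) (0 ∷ []) ⟩
  W k (suc n) ++ φ k (Wdesc k n) ++ 0 ∷ []   ≡⟨ cong (W k (suc n) ++_) (φ-Wdesc k n) ⟩
  W k (suc n) ++ Wdesc k (suc n)             ∎
  where open ≡-Reasoning

W≡Wdesc++[n] : (k : ℕ) → .{{_ : NonZero k}} → (n : ℕ) → n ≤ k ∸ 1 →
               W k n ≡ Wdesc k n ++ n ∷ []
W≡Wdesc++[n] k zero    _       = refl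
W≡Wdesc++[n] k (suc n) 1+n≤k∸1 = begin
  φ k (W k n)                               ≡⟨ cong (φ k) (W≡Wdesc++[n] k n n≤k∸1) ⟩
  φ k (Wdesc k n ++ n ∷ [])                 ≡⟨ φ-++ k (Wdesc k n) (n ∷ []) ⟩
  φ k (Wdesc k n) ++ φ k (n ∷ [])           ≡⟨ cong (φ k (Wdesc k n) ++_) (trans (φ-[ k ] n) (φ-letter-<∸1 k n 1+n≤k∸1)) ⟩
  φ k (Wdesc k n) ++ 0 ∷ suc n ∷ []         ≡⟨ sym (++-assoc (φ k (Wdesc k n)) (0 ∷ []) (suc n ∷ [])) ⟩
  (φ k (Wdesc k n) ++ 0 ∷ []) ++ suc n ∷ [] ≡⟨ cong (_++ suc n ∷ []) (φ-Wdesc k n) ⟩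
  Wdesc k (suc n) ++ suc n ∷ []             ∎
  where
  open ≡-Reasoning
  n≤k∸1 : n ≤ k ∸ 1
  n≤k∸1 = ≤-trans (n≤1+n n) 1+n≤k∸1

lemma4p1 : (k : ℕ) → .{{_ : NonZero k}} → 3 ≤ k → (n : ℕ) → 1 ≤ n → n ≤ k ∸ 1 →
    W k n ≡ Wdesc k n ++ (n ∷ [])
lemma4p1 k _ n _ n≤k∸1 = W≡Wdesc++[n] k n n≤k∸1
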